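{- Let $R=(V,A)$ with $n=|V|$ be a connected digraph (request graph) which has $n-1$ forced edges and these forced edges form a tree $T$ that is a tree representation of $R$. Then each edge of $T$ can be given an appearance time (a positive integer) so that the resulting temporal graph $\mathcal G=(V,\{(e,t_e):e\in E(T)\})$ is a solution for $R$, i.e. for every arc $(u,v)\in A$ there is a journey from $u$ to $v$ in $\mathcal G$.
   Context: A digraph is connected if its underlying undirected graph is connected. A forced edge of $R$ is an unordered pair $\{u,v\}$ with both $(u,v)\in A$ and $(v,u)\in A$. A closed walk of a digraph is a sequence $(u_0,\dots,u_k)$, $k\ge1$, with $(u_i,u_{i+1})$ an arc and $u_k=u_0$. A tree representation of $R$ is a tree $T$ on $V$ such that the induced subgraph $T[S]$ is connected for the vertex set $S$ of every closed walk of $R$. A temporal graph consists of temporal edges $(\{u,v\},t)$ with $t$ a positive integer; a journey from $u_0$ to $u_k$ is a sequence $(u_0,u_1,t_0),\dots,(u_{k-1},u_k,t_{k-1})$ of temporal edges $(\{u_i,u_{i+1}\},t_i)$ with $t_0<\dots<t_{k-1}$. -}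

module Defs where

open import Data.Nat using (ℕ; zero; suc; _<_; _≤_; _∸_; _<ᵇ_)
open import Data.Fin using (Fin; toℕ)
open import Data.Bool using (Bool; true; false; _∧_; _∨_; T)
open import Data.List using (List; []; _∷_; length; filterᵇ; cartesianProduct; allFin)
open import Data.List.Relation.Unary.Linked using (Linked)
open import Data.List.Relation.Unary.All using (All)
open import Data.List.Relation.Unary.Unique.Propositional using (Unique)
open import Data.List.Membership.Propositional using (_∈_)
open import Data.Product using (Σ; _×_; ∃; proj₁; proj₂; _,_)
open import Relation.Binary.PropositionalEquality using (_≡_)
open import Relation.Nullary using (¬_)

record Digraph (n : ℕ) : Set where
  field
    arc      : Fin n → Fin n → Bool
    loopless : ∀ u → arc u u ≡ false
open Digraph public

Arc : ∀ {n} → Digraph n → Fin n → Fin n → Set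
Arc R u v = T (arc R u v)

lastOr : ∀ {A : Set} → A → List A → A
lastOr x []       = x
lastOr x (y ∷ ys) = lastOr y ys

IsWalk : ∀ {A : Set} → (A → A → Set) → A → A → List A → Set
IsWalk E x y ws = Linked E (x ∷ ws) × lastOr x ws ≡ y

-- Undirected graph connected (relation E used in both directions not assumed:
-- callers pass a symmetric relation).
Connected : ∀ {n} → (Fin n → Fin n → Set) → Set
Connected {n} E = ∀ (x y : Fin n) → ∃ λ ws → IsWalk E x y ws

UArc : ∀ {n} → Digraph n → Fin n → Fin n → Set
UArc R u v = T (arc R u v ∨ arc R v u)

ConnectedDigraph : ∀ {n} → Digraph n → Set
ConnectedDigraph R = Connected (UArc R)

forced : ∀ {n} → Digraph n → Fin n → Fin n → Bool
forced R u v = arc R u v ∧ arc R v u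

ForcedEdge : ∀ {n} → Digraph n → Fin n → Fin n → Set
ForcedEdge R u v = T (forced R u v)

forcedCount : ∀ {n} → Digraph n → ℕ
forcedCount {n} R =
  length (filterᵇ (λ p → (toℕ (proj₁ p) <ᵇ toℕ (proj₂ p)) ∧ forced R (proj₁ p) (proj₂ p))
                  (cartesianProduct (allFin n) (allFin n)))

-- A cycle in an undirected graph E: at least 3 distinct vertices
-- v₀ … v_k, consecutive ones adjacent, and v_k adjacent to v₀.
IsCycle : ∀ {n} → (Fin n → Fin n → Set) → List (Fin n) → Set
IsCycle E []       = Data.Empty.⊥ where import Data.Empty
IsCycle E (x ∷ xs) =
  (2 ≤ length xs) × Unique (x ∷ xs) × Linked E (x ∷ xs) × E (lastOr x xs) x

Acyclic : ∀ {n} → (Fin n → Fin n → Set) → Set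
Acyclic {n} E = ∀ (c : List (Fin n)) → ¬ IsCycle E c

IsTree : ∀ {n} → (Fin n → Fin n → Set) → Set
IsTree E = Connected E × Acyclic E

IsClosedWalk : ∀ {n} → Digraph n → List (Fin n) → Set
IsClosedWalk R []       = Data.Empty.⊥ where import Data.Empty
IsClosedWalk R (x ∷ xs) = (1 ≤ length xs) × IsWalk (Arc R) x x xs

InducedConnected : ∀ {n} → (Fin n → Fin n → Set) → List (Fin n) → Set
InducedConnected E S =
  ∀ x y → x ∈ S → y ∈ S → ∃ λ ws → IsWalk E x y ws × All (_∈ S) ws

IsTreeRepresentation : ∀ {n} → Digraph n → (Fin n → Fin n → Set) → Set
IsTreeRepresentation {n} R E =
  IsTree E × (∀ (w : List (Fin n)) → IsClosedWalk R w → InducedConnected E w)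

edgeTimes : ∀ {n} → (Fin n → Fin n → ℕ) → List (Fin n) → List ℕ
edgeTimes τ []            = []
edgeTimes τ (x ∷ [])      = []
edgeTimes τ (x ∷ y ∷ ys)  = τ x y ∷ edgeTimes τ (y ∷ ys)

IsJourney : ∀ {n} → (Fin n → Fin n → Set) → (Fin n → Fin n → ℕ) →
            Fin n → Fin n → List (Fin n) → Set
IsJourney E τ x y ws = IsWalk E x y ws × Linked _<_ (edgeTimes τ (x ∷ ws))

IsTimeLabelling : ∀ {n} → (Fin n → Fin n → Set) → (Fin n → Fin n → ℕ) → Set
IsTimeLabelling {n} E τ =
  (∀ (u v : Fin n) → E u v → 1 ≤ τ u v) × (∀ (u v : Fin n) → E u v → τ u v ≡ τ v u)

{-# OPTIONS --safe #-}
-- For a vertex w of the tree T of forced edges, write a ≺_w b when the tree path of some arc of R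
-- passes a, w, b consecutively: a journey along that path must use the edge wa before the edge wb.
-- A cycle of ≺_w would give a closed walk of R avoiding w whose vertex set contains a and b; as T is
-- a tree representation, T restricted to that set is connected, so it contains the tree path a, w, b,
-- which is absurd. Hence each ≺_w has a topological rank ρ_w. On a tree there is a potential φ with
-- φ x + ρ_x y = φ y + ρ_y x on every edge xy, and giving xy the time φ x + ρ_x y (order-preservingly
-- moved into the positive integers) makes the tree path of every arc a journey.
module Submission where

open import Defs
open import Level using (0ℓ)
open import Function using (_∘_; Equivalence)
open import Data.Nat using (ℕ; zero; suc; _∸_; _≤_; _<_; z≤n; s≤s; _≤?_)
open import Data.Nat.Properties using (≤-trans; n≤1+n; m≤n⇒m≤1+n; ≰⇒>)
open import Data.Integer using (ℤ; +_; 0ℤ; _-_; +<+) renaming (_+_ to _+ℤ_; _<_ to _<ℤ_)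
import Data.Integer.Properties as ℤ
open import Data.Integer.Tactic.RingSolver using (solve-∀)
open import Data.Bool using (T)
open import Data.Bool.Properties using (T-∧; T?)
open import Data.Fin using (Fin; zero; suc; _≟_)
open import Data.Fin.Properties using (any?; pigeonhole; <⇒≢; toℕ<n)
open import Data.List using (List; []; _∷_; _++_; [_]; _∷ʳ_; length; lookup; allFin; cartesianProduct)
open import Data.List.Properties using (++-assoc; ∷-injectiveʳ)
open import Data.List.Relation.Unary.Linked as Linked using (Linked; []; [-]; _∷_)
open import Data.List.Relation.Unary.All as All using (All; []; _∷_)
import Data.List.Relation.Unary.All.Properties as All
open import Data.List.Relation.Unary.Any using (here; there)
open import Data.List.Relation.Unary.Unique.Propositional using (Unique; []; _∷_)
import Data.List.Relation.Unary.Unique.Propositional.Properties as Unique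
open import Data.List.Relation.Binary.Infix.Heterogeneous as Infix using (Infix; MkView; toView)
open import Data.List.Relation.Binary.Infix.Heterogeneous.Properties using (infix?)
open import Data.List.Relation.Binary.Prefix.Heterogeneous using ([]; _∷_)
open import Data.List.Relation.Binary.Pointwise using ([]; _∷_)
open import Data.List.Relation.Binary.Subset.Propositional using (_⊆_)
open import Data.List.Relation.Binary.Subset.Propositional.Properties using (∷⁺ʳ; xs⊆xs++ys)
open import Data.List.Membership.Propositional using (_∈_; _∉_)
open import Data.List.Membership.Propositional.Properties
  using (∈-++⁺ʳ; ∈-++⁻; ∈-∃++; ∈-lookup; ∈-allFin; ∈-cartesianProduct⁺)
import Data.List.Membership.DecPropositional as DecMembership
open import Data.Product using (Σ; _×_; ∃; ∃₂; proj₁; proj₂; _,_; swap; uncurry)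
open import Data.Sum using (_⊎_; inj₁; inj₂)
open import Data.Empty using (⊥; ⊥-elim)
open import Relation.Nullary using (¬_; yes; no; contradiction)
open import Relation.Nullary.Decidable using (_×-dec_; _⊎-dec_)
open import Relation.Unary using () renaming (Decidable to Decidable₁)
open import Relation.Binary
  using (Decidable; DecidableEquality; Symmetric; DecStrictPartialOrder; StrictTotalOrder)
open import Relation.Binary.PropositionalEquality
  using (_≡_; _≢_; refl; sym; trans; cong; subst; module ≡-Reasoning)

module _ {A : Set} where

  lastOr-∈ : ∀ (x : A) ws → lastOr x ws ∈ x ∷ ws
  lastOr-∈ x []       = here refl
  lastOr-∈ x (y ∷ ws) = there (lastOr-∈ y ws)

  2≤length-∷-∷ʳ : ∀ (x : A) xs y → 2 ≤ length (x ∷ xs ∷ʳ y)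
  2≤length-∷-∷ʳ x []      y = s≤s (s≤s z≤n)
  2≤length-∷-∷ʳ x (_ ∷ _) y = s≤s (s≤s z≤n)

  Unique-++⁻ˡ : ∀ xs {ys : List A} → Unique (xs ++ ys) → Unique xs
  Unique-++⁻ˡ []       _          = []
  Unique-++⁻ˡ (x ∷ xs) (x∉ ∷ xs!) = All.++⁻ˡ xs x∉ ∷ Unique-++⁻ˡ xs xs!

  Unique-++⁻ʳ : ∀ xs {ys : List A} → Unique (xs ++ ys) → Unique ys
  Unique-++⁻ʳ []       ys!       = ys!
  Unique-++⁻ʳ (x ∷ xs) (_ ∷ xs!) = Unique-++⁻ʳ xs xs!

  Unique-∷ʳ : ∀ {xs} {y : A} → Unique xs → y ∉ xs → Unique (xs ∷ʳ y)
  Unique-∷ʳ xs! y∉ = Unique.++⁺ xs! ([] ∷ []) λ { (y∈ , here refl) → y∉ y∈ }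

  Unique-middle : ∀ xs {y : A} {ys} → Unique (xs ++ y ∷ ys) → All (y ≢_) (xs ++ ys)
  Unique-middle []       (y∉ ∷ _)   = y∉
  Unique-middle (x ∷ xs) (x∉ ∷ xs!) =
    (λ y≡x → All.lookup x∉ (∈-++⁺ʳ xs (here refl)) (sym y≡x)) ∷ Unique-middle xs xs!

  Unique-lookup-injective : ∀ {xs : List A} → Unique xs → ∀ {i j} → lookup xs i ≡ lookup xs j → i ≡ j
  Unique-lookup-injective (_  ∷ _)   {zero}  {zero}  _  = refl
  Unique-lookup-injective (x∉ ∷ _)   {zero}  {suc j} eq = ⊥-elim (All.lookup x∉ (∈-lookup j) eq)
  Unique-lookup-injective (x∉ ∷ _)   {suc i} {zero}  eq = ⊥-elim (All.lookup x∉ (∈-lookup i) (sym eq))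
  Unique-lookup-injective (_  ∷ xs!) {suc i} {suc j} eq = cong suc (Unique-lookup-injective xs! eq)

  Consecutive : A → A → A → List A → Set
  Consecutive a w b = Infix _≡_ (a ∷ w ∷ b ∷ [])

  consecutive-split : ∀ {a w b L} → Consecutive a w b L → ∃₂ λ X Y → L ≡ X ++ a ∷ w ∷ b ∷ Y
  consecutive-split c with MkView X (refl ∷ refl ∷ refl ∷ []) Y ← toView c = X , Y , refl

Unique⇒length≤ : ∀ {n} {xs : List (Fin n)} → Unique xs → length xs ≤ n
Unique⇒length≤ {n} {xs} xs! with length xs ≤? n
... | yes ≤n = ≤n
... | no  ≰n with i , j , i<j , eq ← pigeonhole (≰⇒> ≰n) (lookup xs) =
  contradiction (Unique-lookup-injective xs! eq) (<⇒≢ i<j)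

module _ {A : Set} where

  count : {P : A → Set} → Decidable₁ P → List A → ℕ
  count P? []       = 0
  count P? (x ∷ xs) with P? x
  ... | yes _ = suc (count P? xs)
  ... | no  _ = count P? xs

  module _ {P Q : A → Set} (P? : Decidable₁ P) (Q? : Decidable₁ Q) (P⇒Q : ∀ {x} → P x → Q x) where

    count-mono : ∀ xs → count P? xs ≤ count Q? xs
    count-mono []       = z≤n
    count-mono (x ∷ xs) with P? x | Q? x
    ... | yes _  | yes _  = s≤s (count-mono xs)
    ... | yes px | no ¬qx = contradiction (P⇒Q px) ¬qx
    ... | no  _  | yes _  = m≤n⇒m≤1+n (count-mono xs)
    ... | no  _  | no  _  = count-mono xs

    count-mono-< : ∀ {y xs} → y ∈ xs → Q y → ¬ P y → count P? xs < count Q? xs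
    count-mono-< {xs = x ∷ xs} (here refl) qy ¬py with P? x | Q? x
    ... | yes py | _      = contradiction py ¬py
    ... | no  _  | yes _  = s≤s (count-mono xs)
    ... | no  _  | no ¬qy = contradiction qy ¬qy
    count-mono-< {xs = x ∷ xs} (there y∈) qy ¬py with P? x | Q? x
    ... | yes _  | yes _  = s≤s (count-mono-< y∈ qy ¬py)
    ... | yes px | no ¬qx = contradiction (P⇒Q px) ¬qx
    ... | no  _  | yes _  = m≤n⇒m≤1+n (count-mono-< y∈ qy ¬py)
    ... | no  _  | no  _  = count-mono-< y∈ qy ¬py

module _ (O : DecStrictPartialOrder 0ℓ 0ℓ 0ℓ) where
  open DecStrictPartialOrder O
    using (Carrier; _<?_; irrefl; module Eq) renaming (_<_ to _⊏_; trans to ⊏-trans)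

  countBelow : ∀ {A : Set} → (A → Carrier) → List A → Carrier → ℕ
  countBelow f xs z = count (λ x → f x <? z) xs

  countBelow-mono-< : ∀ {A : Set} (f : A → Carrier) {xs a z} →
                      a ∈ xs → f a ⊏ z → countBelow f xs (f a) < countBelow f xs z
  countBelow-mono-< f a∈ fa⊏z =
    count-mono-< _ _ (λ fx⊏fa → ⊏-trans fx⊏fa fa⊏z) a∈ fa⊏z (irrefl Eq.refl)

ℤ-<-decStrictPartialOrder : DecStrictPartialOrder 0ℓ 0ℓ 0ℓ
ℤ-<-decStrictPartialOrder = StrictTotalOrder.decStrictPartialOrder ℤ.<-strictTotalOrder

+-insert-difference : ∀ p a b → p +ℤ a ≡ (p +ℤ (a - b)) +ℤ b
+-insert-difference = solve-∀

module _ {A : Set} where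

  pathSum : (A → A → ℤ) → A → List A → ℤ
  pathSum δ x []       = 0ℤ
  pathSum δ x (y ∷ ys) = δ x y +ℤ pathSum δ y ys

  pathSum-∷ʳ : ∀ δ x ys z → pathSum δ x (ys ∷ʳ z) ≡ pathSum δ x ys +ℤ δ (lastOr x ys) z
  pathSum-∷ʳ δ x []       z = trans (ℤ.+-identityʳ (δ x z)) (sym (ℤ.+-identityˡ (δ x z)))
  pathSum-∷ʳ δ x (y ∷ ys) z =
    trans (cong (δ x y +ℤ_) (pathSum-∷ʳ δ y ys z)) (sym (ℤ.+-assoc (δ x y) _ _))

IsPath : ∀ {A : Set} → (A → A → Set) → A → A → List A → Set
IsPath E x y ws = IsWalk E x y ws × Unique (x ∷ ws)

module _ {A : Set} {E : A → A → Set} where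

  walk-edge : ∀ {x y} → E x y → IsWalk E x y [ y ]
  walk-edge e = e ∷ [-] , refl

  walk-tail : ∀ {x y z ws} → IsWalk E x y (z ∷ ws) → IsWalk E z y ws
  walk-tail (_ ∷ l , last) = l , last

  walk-++ : ∀ {x y z} ws {vs} → IsWalk E x y ws → IsWalk E y z vs → IsWalk E x z (ws ++ vs)
  walk-++ []       (_ , refl)     w₂ = w₂
  walk-++ (_ ∷ ws) (e ∷ l , last) w₂ with l′ , last′ ← walk-++ ws (l , last) w₂ = e ∷ l′ , last′

  walk-map : ∀ {F : A → A → Set} → (∀ {a b} → E a b → F a b) →
             ∀ {x y ws} → IsWalk E x y ws → IsWalk F x y ws
  walk-map f (l , last) = Linked.map f l , last

  walk-reverse : Symmetric E → ∀ {x y} ws → IsWalk E x y ws →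
                 ∃ λ vs → IsWalk E y x vs × y ∷ vs ⊆ x ∷ ws
  walk-reverse E-sym []       (_ , refl) = [] , ([-] , refl) , λ m∈ → m∈
  walk-reverse E-sym {x} {y} (z ∷ zs) w@(e ∷ _ , _)
    with vs , y→z , ⊆z∷zs ← walk-reverse E-sym zs (walk-tail w) =
    vs ++ [ x ] , walk-++ vs y→z (walk-edge (E-sym e)) , ⊆x∷z∷zs
    where
    ⊆x∷z∷zs : y ∷ vs ++ [ x ] ⊆ x ∷ z ∷ zs
    ⊆x∷z∷zs m∈ with ∈-++⁻ (y ∷ vs) m∈
    ... | inj₁ m∈y∷vs      = there (⊆z∷zs m∈y∷vs)
    ... | inj₂ (here refl) = here refl

  walk-split : ∀ X {x y m ws Z} → x ∷ ws ≡ X ++ m ∷ Z → IsWalk E x y ws →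
               (∃ λ ws₁ → x ∷ ws₁ ≡ X ∷ʳ m × IsWalk E x m ws₁) × IsWalk E m y Z
  walk-split []           refl w              = ([] , refl , [-] , refl) , w
  walk-split (_ ∷ [])     refl w@(e ∷ _ , _) = (_ , refl , walk-edge e) , walk-tail w
  walk-split (x ∷ x′ ∷ X) refl w@(e ∷ _ , _)
    with (ws₁ , eq₁ , l₁ , last₁) , w₂ ← walk-split (x′ ∷ X) refl (walk-tail w) =
    (x′ ∷ ws₁ , cong (x ∷_) eq₁ , e ∷ l₁ , last₁) , w₂

  path-split : ∀ X {x y m ws Z} → x ∷ ws ≡ X ++ m ∷ Z → IsPath E x y ws →
               (∃ λ ws₁ → x ∷ ws₁ ≡ X ∷ʳ m × IsPath E x m ws₁) × IsPath E m y Z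
  path-split X {m = m} {Z = Z} split (w , x∷ws!)
    with (ws₁ , eq₁ , w₁) , w₂ ← walk-split X split w =
    (ws₁ , eq₁ , w₁ , subst Unique (sym eq₁) (Unique-++⁻ˡ (X ∷ʳ m) X∷ʳm++Z!)) , w₂ , Unique-++⁻ʳ X X++m∷Z!
    where
    X++m∷Z! : Unique (X ++ m ∷ Z)
    X++m∷Z! = subst Unique split x∷ws!
    X∷ʳm++Z! : Unique ((X ∷ʳ m) ++ Z)
    X∷ʳm++Z! = subst Unique (sym (++-assoc X [ m ] Z)) X++m∷Z!

  consecutive-path : ∀ {u v p a w b} → IsPath E u v p → Consecutive a w b (u ∷ p) →
                     IsPath E a b (w ∷ b ∷ [])
  consecutive-path P c with X , Y , split ← consecutive-split c
    with _ , ((e₁ ∷ e₂ ∷ _ , _) , a∷w∷b∷Y!) ← path-split X split P =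
    (e₁ ∷ e₂ ∷ [-] , refl) , Unique-++⁻ˡ (_ ∷ _ ∷ _ ∷ []) a∷w∷b∷Y!

  walks-around : Symmetric E → ∀ {u v p a w b} → IsPath E u v p → Consecutive a w b (u ∷ p) →
                 (∃ λ vs → IsWalk E a u vs × All (w ≢_) (a ∷ vs)) ×
                 (∃ λ vs → IsWalk E v b vs × All (w ≢_) (v ∷ vs))
  walks-around E-sym {a = a} {w} {b} P c with X , Y , split ← consecutive-split c
    with (ws₁ , eq₁ , u→a , _) , (a→v , _) ← path-split X split P
    with vs₁ , a→u , ⊆₁ ← walk-reverse E-sym ws₁ u→a
       | vs₂ , v→b , ⊆₂ ← walk-reverse E-sym Y (walk-tail (walk-tail a→v)) =
    (vs₁ , a→u , All.anti-mono ⊆₁ (subst (All (w ≢_)) (sym eq₁) avoidsˡ)) ,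
    (vs₂ , v→b , All.anti-mono ⊆₂ avoidsʳ)
    where
    avoids : All (w ≢_) ((X ∷ʳ a) ++ b ∷ Y)
    avoids = Unique-middle (X ∷ʳ a) (subst Unique (trans split (sym (++-assoc X [ a ] _))) (proj₂ P))
    avoidsˡ : All (w ≢_) (X ∷ʳ a)
    avoidsˡ = All.++⁻ˡ (X ∷ʳ a) avoids
    avoidsʳ : All (w ≢_) (b ∷ Y)
    avoidsʳ = All.++⁻ʳ (X ∷ʳ a) avoids

module _ {A : Set} (_≟ᴬ_ : DecidableEquality A) {E : A → A → Set} where
  open DecMembership _≟ᴬ_ using (_∈?_)

  walk⇒path : ∀ {x y} ws → IsWalk E x y ws → ∃ λ vs → IsPath E x y vs × vs ⊆ ws
  walk⇒path []       w = [] , (w , [] ∷ []) , λ ()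
  walk⇒path {x} (z ∷ zs) w@(e ∷ _ , _)
    with vs , P@((l , last) , z∷vs!) , vs⊆zs ← walk⇒path zs (walk-tail w)
    with x ∈? (z ∷ vs)
  ... | no x∉  = z ∷ vs , ((e ∷ l , last) , All.¬Any⇒All¬ _ x∉ ∷ z∷vs!) , ∷⁺ʳ z vs⊆zs
  ... | yes x∈ with P₀ , Q , split ← ∈-∃++ x∈ =
    Q , proj₂ (path-split P₀ split P) ,
    λ q∈ → ∷⁺ʳ z vs⊆zs (subst (_ ∈_) (sym split) (∈-++⁺ʳ P₀ (there q∈)))

module Tree {n : ℕ} {E : Fin n → Fin n → Set}
            (E-sym : Symmetric E) (E-irrefl : ∀ {x} → ¬ E x x) (tree : IsTree E) where
  open DecMembership (_≟_ {n}) using (_∈?_)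

  private
    connected : Connected E
    connected = proj₁ tree
    acyclic : Acyclic E
    acyclic = proj₂ tree

  shortcut-free : ∀ {x y ws} → IsPath E x y ws → E y x → 2 ≤ length ws → ⊥
  shortcut-free {x} {ws = ws} ((l , last) , x∷ws!) e 2≤ =
    acyclic (x ∷ ws) (2≤ , x∷ws! , l , subst (λ z → E z x) (sym last) e)

  path-to-self : ∀ {x ps} → IsPath E x x ps → ps ≡ []
  path-to-self {ps = []}     _                      = refl
  path-to-self {ps = p ∷ ps} ((_ , last) , x∉ ∷ _) =
    contradiction refl (All.lookup x∉ (subst (_∈ p ∷ ps) last (lastOr-∈ p ps)))

  path-unique : ∀ {x y} ps qs → IsPath E x y ps → IsPath E x y qs → ps ≡ qs
  path-unique ps       []       P ((_ , refl) , _) = path-to-self P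
  path-unique []       (_ ∷ _)  ((_ , refl) , _) Q = sym (path-to-self Q)
  path-unique {x} ps@(_ ∷ _) (b ∷ qs) P@((l , last) , x∷ps!) ((e ∷ l′ , last′) , x∉ ∷ b∷qs!)
    with b ∈? ps
  ... | no b∉ps = contradiction refl (All.lookup x∉ (there (subst (x ∈_) x∷ps≡qs (here refl))))
    where
    b≢x : b ≢ x
    b≢x refl = E-irrefl e
    x∷ps≡qs : x ∷ ps ≡ qs
    x∷ps≡qs = path-unique (x ∷ ps) qs
      ((E-sym e ∷ l , last) , (b≢x ∷ All.¬Any⇒All¬ ps b∉ps) ∷ x∷ps!) ((l′ , last′) , b∷qs!)
  ... | yes b∈ps with P₀ , Q₀ , split ← ∈-∃++ b∈ps
    with (ws₁ , eq₁ , x→b) , b→y ← path-split (x ∷ P₀) (cong (x ∷_) split) P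
    with refl ← path-unique Q₀ qs b→y ((l′ , last′) , b∷qs!)
    with P₀
  ...   | []     = split
  ...   | c ∷ P′ = ⊥-elim (shortcut-free x→b (E-sym e)
                     (subst (λ ws → 2 ≤ length ws) (sym (∷-injectiveʳ eq₁)) (2≤length-∷-∷ʳ c P′ b)))

  path : Fin n → Fin n → List (Fin n)
  path x y = proj₁ (walk⇒path _≟_ _ (proj₂ (connected x y)))

  path-isPath : ∀ x y → IsPath E x y (path x y)
  path-isPath x y = proj₁ (proj₂ (walk⇒path _≟_ _ (proj₂ (connected x y))))

  path-≡ : ∀ {x y ps} → IsPath E x y ps → ps ≡ path x y
  path-≡ P = path-unique _ _ P (path-isPath _ _)

  module Rooted (r : Fin n) where

    path-extend : ∀ {x y} → E x y → y ∉ r ∷ path r x → path r y ≡ path r x ∷ʳ y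
    path-extend {x} e y∉ =
      sym (path-≡ (walk-++ (path r x) (proj₁ (path-isPath r x)) (walk-edge e) ,
                   Unique-∷ʳ (proj₂ (path-isPath r x)) y∉))

    path-retract : ∀ {x y} → E x y → y ∈ path r x → path r x ≡ path r y ∷ʳ x
    path-retract {x} {y} e y∈ with P , Q , split ← ∈-∃++ y∈
      with (ws₁ , eq₁ , r→y) , y→x ← path-split (r ∷ P) (cong (r ∷_) split) (path-isPath r x) =
      begin
        path r x        ≡⟨ split ⟩
        P ++ y ∷ Q      ≡⟨ cong (λ Q → P ++ y ∷ Q) (path-unique Q [ x ] y→x edge) ⟩
        P ++ y ∷ [ x ]  ≡⟨ sym (++-assoc P [ y ] [ x ]) ⟩
        P ∷ʳ y ∷ʳ x     ≡⟨ cong (_∷ʳ x) (trans (sym (∷-injectiveʳ eq₁)) (path-≡ r→y)) ⟩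
        path r y ∷ʳ x   ∎
      where
      open ≡-Reasoning
      edge : IsPath E y x [ x ]
      edge = walk-edge (E-sym e) , ((λ { refl → E-irrefl e }) ∷ []) ∷ [] ∷ []

    edge-path : ∀ {x y} → E x y → path r y ≡ path r x ∷ʳ y ⊎ path r x ≡ path r y ∷ʳ x
    edge-path {x} {y} e with y ∈? (r ∷ path r x)
    ... | no  y∉          = inj₁ (path-extend e y∉)
    ... | yes (there y∈)  = inj₂ (path-retract e y∈)
    ... | yes (here refl) = inj₂ (path-extend (E-sym e) x∉)
      where
      x∉ : x ∉ r ∷ path r r
      x∉ x∈ with subst (λ ps → x ∈ r ∷ ps) (path-to-self (path-isPath r r)) x∈
      ... | here refl = E-irrefl e

    module _ (h : Fin n → Fin n → ℤ) where

      δ : Fin n → Fin n → ℤ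
      δ x y = h x y - h y x

      potential : Fin n → ℤ
      potential c = pathSum δ r (path r c)

      potential-child : ∀ {x y} → path r y ≡ path r x ∷ʳ y → potential y ≡ potential x +ℤ δ x y
      potential-child {x} {y} eq = begin
        potential y                               ≡⟨ cong (pathSum δ r) eq ⟩
        pathSum δ r (path r x ∷ʳ y)               ≡⟨ pathSum-∷ʳ δ r (path r x) y ⟩
        potential x +ℤ δ (lastOr r (path r x)) y  ≡⟨ cong (λ z → potential x +ℤ δ z y) (proj₂ (proj₁ (path-isPath r x))) ⟩
        potential x +ℤ δ x y                      ∎
        where open ≡-Reasoning

      potential-balanced : ∀ {x y} → E x y → potential x +ℤ h x y ≡ potential y +ℤ h y x
      potential-balanced {x} {y} e with edge-path e
      ... | inj₁ eq = trans (+-insert-difference (potential x) (h x y) (h y x))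
                            (cong (_+ℤ h y x) (sym (potential-child eq)))
      ... | inj₂ eq = sym (trans (+-insert-difference (potential y) (h y x) (h x y))
                                 (cong (_+ℤ h x y) (sym (potential-child eq))))

module Ranking {n : ℕ} {_≺_ : Fin n → Fin n → Set} (_≺?_ : Decidable _≺_)
               (cycle-free : ∀ {a c cs} → ¬ IsWalk _≺_ a a (c ∷ cs)) where

  Reaches : ℕ → Fin n → Fin n → Set
  Reaches zero    c a = ⊥
  Reaches (suc k) c a = c ≺ a ⊎ ∃ λ d → c ≺ d × Reaches k d a

  reaches? : ∀ k → Decidable (Reaches k)
  reaches? zero    c a = no λ ()
  reaches? (suc k) c a = (c ≺? a) ⊎-dec any? (λ d → (c ≺? d) ×-dec reaches? k d a)

  reaches⇒walk : ∀ k {c a} → Reaches k c a → ∃₂ λ d ws → IsWalk _≺_ c a (d ∷ ws)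
  reaches⇒walk (suc k) (inj₁ c≺a) = _ , [] , walk-edge c≺a
  reaches⇒walk (suc k) (inj₂ (d , c≺d , reach)) with _ , ws , (l , last) ← reaches⇒walk k reach =
    d , _ ∷ ws , (c≺d ∷ l , last)

  walk⇒reaches : ∀ k {c a d} ws → IsWalk _≺_ c a (d ∷ ws) → length ws < k → Reaches k c a
  walk⇒reaches (suc k) []       (c≺a ∷ [-] , refl) _        = inj₁ c≺a
  walk⇒reaches (suc k) (_ ∷ ws) (c≺d ∷ l , last)  (s≤s lt) = inj₂ (_ , c≺d , walk⇒reaches k ws (l , last) lt)

  -- A loop-erased walk from c to some b ≢ c has fewer than n steps.
  reaches-step : ∀ {c a b} → Reaches n c a → a ≺ b → Reaches n c b
  reaches-step {c} {a} {b} reach a≺b with d , ws , c→a ← reaches⇒walk n reach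
    with walk-++ (d ∷ ws) c→a (walk-edge a≺b) | c ≟ b
  ... | closed | yes refl = contradiction closed cycle-free
  ... | c→b    | no c≢b with walk⇒path _≟_ _ c→b
  ...   | []     , ((_ , c≡b) , _) , _ = contradiction c≡b c≢b
  ...   | _ ∷ vs , (c⇝b , c∷vs!) , _ = walk⇒reaches n vs c⇝b (≤-trans (n≤1+n _) (Unique⇒length≤ c∷vs!))

  rank : Fin n → ℕ
  rank a = count (λ c → reaches? n c a) (allFin n)

  rank-mono : ∀ {a b} → a ≺ b → rank a < rank b
  rank-mono {a} {b} a≺b =
    count-mono-< (λ c → reaches? n c a) (λ c → reaches? n c b) (λ reach → reaches-step reach a≺b)
      (∈-allFin a) (walk⇒reaches n [] (walk-edge a≺b) (≤-trans (s≤s z≤n) (toℕ<n a)))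
      (λ reach → cycle-free (proj₂ (proj₂ (reaches⇒walk n reach))))

edgeTimes-increasing : ∀ {n} (τ : Fin n → Fin n → ℕ) L →
                       (∀ {a w b} → Consecutive a w b L → τ a w < τ w b) → Linked _<_ (edgeTimes τ L)
edgeTimes-increasing τ []              _   = []
edgeTimes-increasing τ (_ ∷ [])        _   = []
edgeTimes-increasing τ (_ ∷ _ ∷ [])    _   = [-]
edgeTimes-increasing τ (_ ∷ _ ∷ _ ∷ L) inc =
  inc (Infix.here (refl ∷ refl ∷ refl ∷ [])) ∷ edgeTimes-increasing τ (_ ∷ _ ∷ L) (inc ∘ Infix.there)

module _ {n : ℕ} (R : Digraph n) where

  forced-sym : Symmetric (ForcedEdge R)
  forced-sym {u} {v} t = Equivalence.from (T-∧ {arc R v u}) (swap (Equivalence.to (T-∧ {arc R u v}) t))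

  forced⇒arc : ∀ {u v} → ForcedEdge R u v → Arc R u v
  forced⇒arc {u} {v} t = proj₁ (Equivalence.to (T-∧ {arc R u v} {arc R v u}) t)

  forced-irrefl : ∀ {u} → ¬ ForcedEdge R u u
  forced-irrefl {u} t = subst T (loopless R u) (forced⇒arc t)

  module Schedule (representation : IsTreeRepresentation R (ForcedEdge R)) (root : Fin n) where
    open Tree forced-sym forced-irrefl (proj₁ representation)
    open Rooted root using (potential; potential-balanced)

    Precedes : Fin n → Fin n → Fin n → Set
    Precedes w a b = ∃₂ λ u v → Arc R u v × Consecutive a w b (u ∷ path u v)

    precedes? : ∀ w → Decidable (Precedes w)
    precedes? w a b = any? λ u → any? λ v → T? (arc R u v) ×-dec infix? _≟_ _ _

    precedes-path : ∀ {w a b} → Precedes w a b → IsPath (ForcedEdge R) a b (w ∷ b ∷ [])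
    precedes-path (u , v , _ , c) = consecutive-path (path-isPath u v) c

    detour : ∀ {w a b} → Precedes w a b → ∃ λ ws → IsWalk (Arc R) a b ws × All (w ≢_) (a ∷ ws)
    detour (u , v , uv , c)
      with (ws₁ , a→u , avoids₁) , (ws₂ , v→b , avoids₂) ← walks-around forced-sym (path-isPath u v) c =
      ws₁ ++ v ∷ ws₂ ,
      walk-++ ws₁ (walk-map forced⇒arc a→u) (walk-++ [ v ] (walk-edge uv) (walk-map forced⇒arc v→b)) ,
      All.++⁺ avoids₁ avoids₂

    detours : ∀ {w a c cs} → IsWalk (Precedes w) a c cs → ∃ λ ws → IsWalk (Arc R) a c ws × All (w ≢_) ws
    detours {cs = []}    (_ , refl)     = [] , ([-] , refl) , []
    detours {cs = _ ∷ _} (p ∷ l , last)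
      with ws₁ , a→b , _ ∷ avoids₁ ← detour p | ws₂ , b→c , avoids₂ ← detours (l , last) =
      ws₁ ++ ws₂ , walk-++ ws₁ a→b b→c , All.++⁺ avoids₁ avoids₂

    precedes-cycle-free : ∀ w {a c cs} → ¬ IsWalk (Precedes w) a a (c ∷ cs)
    precedes-cycle-free w {a} {c} (p ∷ l , last) with detour p | detours (l , last)
    ... | [] , (_ , a≡c) , _ | _ with (_ , (_ ∷ a≢c ∷ []) ∷ _) ← precedes-path p = a≢c a≡c
    ... | ws₁@(_ ∷ _) , a→c , avoids₁ | ws₂ , c→a , avoids₂ = All.lookup (All.++⁺ avoids₁ avoids₂) w∈S refl
      where
      S : List (Fin n)
      S = a ∷ ws₁ ++ ws₂
      c∈S : c ∈ S
      c∈S = xs⊆xs++ys (a ∷ ws₁) ws₂ (subst (_∈ a ∷ ws₁) (proj₂ a→c) (lastOr-∈ a ws₁))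
      w∈S : w ∈ S
      w∈S with qs , a→c-in-S , qs⊆S ← proj₂ representation S (s≤s z≤n , walk-++ ws₁ a→c c→a) a c (here refl) c∈S
        with ps , a⇝c , ps⊆qs ← walk⇒path _≟_ qs a→c-in-S =
        All.lookup qs⊆S (ps⊆qs (subst (w ∈_) (sym (path-unique ps _ a⇝c (precedes-path p))) (here refl)))

    rank : Fin n → Fin n → ℕ
    rank w = Ranking.rank (precedes? w) (precedes-cycle-free w)

    rank-mono : ∀ {w a b} → Precedes w a b → rank w a < rank w b
    rank-mono {w} = Ranking.rank-mono (precedes? w) (precedes-cycle-free w)

    rankℤ : Fin n → Fin n → ℤ
    rankℤ w a = + rank w a

    timeℤ : Fin n → Fin n → ℤ
    timeℤ w a = potential rankℤ w +ℤ rankℤ w a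

    timeℤ-increasing : ∀ {w a b} → Precedes w a b → timeℤ w a <ℤ timeℤ w b
    timeℤ-increasing {w} p = ℤ.+-monoʳ-< (potential rankℤ w) (+<+ (rank-mono p))

    compress : ℤ → ℕ
    compress z =
      suc (countBelow ℤ-<-decStrictPartialOrder (uncurry timeℤ) (cartesianProduct (allFin n) (allFin n)) z)

    compress-mono-< : ∀ {x y z} → timeℤ x y <ℤ z → compress (timeℤ x y) < compress z
    compress-mono-< {x} {y} lt =
      s≤s (countBelow-mono-< ℤ-<-decStrictPartialOrder (uncurry timeℤ)
             (∈-cartesianProduct⁺ (∈-allFin x) (∈-allFin y)) lt)

    time : Fin n → Fin n → ℕ
    time x y = compress (timeℤ x y)

    time-sym : ∀ {x y} → ForcedEdge R x y → time x y ≡ time y x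
    time-sym e = cong compress (potential-balanced rankℤ e)

    journey : ∀ {u v} → Arc R u v → ∃ λ ws → IsJourney (ForcedEdge R) time u v ws
    journey {u} {v} uv =
      path u v , proj₁ (path-isPath u v) , edgeTimes-increasing time (u ∷ path u v) increasing
      where
      increasing : ∀ {a w b} → Consecutive a w b (u ∷ path u v) → time a w < time w b
      increasing {a} {w} {b} c with (aw ∷ _ , _) , _ ← precedes-path (u , v , uv , c) =
        subst (_< time w b) (time-sym (forced-sym aw)) (compress-mono-< {w} {a} (timeℤ-increasing (u , v , uv , c)))

lemma4p18 : ∀ (n : ℕ) (R : Digraph n) →
    ConnectedDigraph R →
    forcedCount R ≡ n ∸ 1 →
    IsTreeRepresentation R (ForcedEdge R) →
    Σ (Fin n → Fin n → ℕ) λ τ →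
    IsTimeLabelling (ForcedEdge R) τ ×
    (∀ (u v : Fin n) → Arc R u v →
    ∃ λ (ws : List (Fin n)) → IsJourney (ForcedEdge R) τ u v ws)
lemma4p18 zero    R _ _ _              = (λ ()) , ((λ ()) , (λ ())) , (λ ())
lemma4p18 (suc m) R _ _ representation =
  time , ((λ _ _ _ → s≤s z≤n) , (λ _ _ → time-sym)) , (λ _ _ → journey)
  where open Schedule R representation zero
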